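{- Let $m\ge 0$ be an integer and let $\Gamma=\{a,b\}$ be a two-letter alphabet graded by $\|a\|=1$ and $\|b\|=m+1$. Let $u,v\in\Gamma^*$ be finite words, let $n=|u\cdot v|_b$ be the total number of occurrences of the letter $b$ in the concatenation $u\cdot v$, and suppose $\|u\|\ge mn+1$ and $\|v\|\ge mn+1$. Then there exist a nonempty prefix $x$ of $u$ and a nonempty prefix $y$ of $v$ such that $\|x\|=\|y\|$.
   Context: For a word $w=w_1\cdots w_\ell\in\Gamma^*$, its weight is $\|w\|=\|w_1\|+\cdots+\|w_\ell\|$ (the empty word has weight $0$), and $|w|_b$ denotes the number of letters of $w$ equal to $b$. A prefix of $w$ is a word $w_1\cdots w_i$ with $0\le i\le \ell$; it is nonempty if $i\ge 1$. -}

module Defs where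

open import Data.Nat using (ℕ; zero; suc; _+_)
open import Data.List using (List; []; _∷_; _++_; length; take)
open import Data.Product using (Σ; _×_; ∃)
open import Relation.Binary.PropositionalEquality using (_≡_)
open import Data.Nat using (_≤_)

data Γ : Set where
  a b : Γ

letterWeight : ℕ → Γ → ℕ
letterWeight m a = 1
letterWeight m b = m + 1

weight : ℕ → List Γ → ℕ
weight m []       = 0
weight m (c ∷ w)  = letterWeight m c + weight m w

count-b : List Γ → ℕ
count-b []       = 0
count-b (a ∷ w)  = count-b w
count-b (b ∷ w)  = suc (count-b w)

IsPrefix : List Γ → List Γ → Set
IsPrefix x w = Σ ℕ λ i → (i ≤ length w) × (x ≡ take i w)

module Submission where

-- Read a word as a walk on ℕ whose steps are its
-- letter weights: a step of 1 for a and of m + 1 = 1 + m·|b|_b for b.  We run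
-- the walks of u and v simultaneously, started at offsets p ≤ q, always
-- advancing the walk that is behind.  Whenever the lagging walk overtakes the
-- leading one it overshoots by at most m, and we pay for this with its b:
-- the invariant  q + m·(|u|_b + |v|_b) ≤ T  (q = the leading position, T a
-- target both walks reach) is preserved, and it rules out the lagging walk
-- running out of letters before the two positions coincide.
--
-- The theorem follows by letting both walks take their first letter
-- (so the prefixes found are nonempty) and starting the leapfrog from there,
-- with target T = mn + 1.

open import Defs
open import Data.Nat using (ℕ; suc; _+_; _*_; _≤_)
open import Data.List using (List; []; _∷_; _++_)
open import Data.Product using (Σ; _×_; ∃; _,_)
open import Relation.Binary.PropositionalEquality using (_≡_; _≢_)

open import Data.Nat using (_<_; z≤n; s≤s)
open import Data.Nat.Properties
  using (≤-refl; ≤-trans; ≤-reflexive; ≤-antisym; ≤-total; m≤n⇒m<n∨m≡n; m≤m+n; n≤1+n;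
         +-comm; +-assoc; +-identityʳ; +-monoˡ-≤; +-monoʳ-≤; *-monoʳ-≤; *-suc; module ≤-Reasoning)
open import Data.Nat.Solver using (module +-*-Solver)
open import Data.List.Relation.Binary.Prefix.Heterogeneous using (Prefix; []; _∷_)
open import Data.Sum using (inj₁; inj₂)
open import Relation.Binary.PropositionalEquality using (refl; sym; trans; cong)
open +-*-Solver using (solve; _:+_; _:*_; _:=_; con)

_⊑_ : List Γ → List Γ → Set
_⊑_ = Prefix _≡_

⊑⇒IsPrefix : ∀ {x w} → x ⊑ w → IsPrefix x w
⊑⇒IsPrefix []         = 0 , z≤n , refl
⊑⇒IsPrefix (refl ∷ p) with i , i≤ , x≡ ← ⊑⇒IsPrefix p = suc i , s≤s i≤ , cong (_ ∷_) x≡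

-- Every letter weighs 1 plus m per occurrence of b: ‖d‖ = 1 + m·|d|_b.
-- This is what converts overshoots of the walks into b-counts.
letter-cost : ∀ m d v → letterWeight m d + m * count-b v ≡ suc (m * count-b (d ∷ v))
letter-cost m a v = refl
letter-cost m b v = trans (cong (_+ m * count-b v) (+-comm m 1)) (cong suc (sym (*-suc m (count-b v))))

count-b-cons : ∀ c u → count-b u ≤ count-b (c ∷ u)
count-b-cons a u = ≤-refl
count-b-cons b u = n≤1+n (count-b u)

count-b-++ : ∀ u v → count-b (u ++ v) ≡ count-b u + count-b v
count-b-++ []      v = refl
count-b-++ (a ∷ u) v = count-b-++ u v
count-b-++ (b ∷ u) v = cong suc (count-b-++ u v)

-- The walks of u and v, started at offsets p and q, meet: some prefixes
-- (possibly empty) end at the same position.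
Meet : (m p q : ℕ) → List Γ → List Γ → Set
Meet m p q u v = Σ (List Γ) λ x → Σ (List Γ) λ y → x ⊑ u × y ⊑ v × p + weight m x ≡ q + weight m y

meet-here : ∀ {m p q u v} → p ≡ q → Meet m p q u v
meet-here p≡q = [] , [] , [] , [] , cong (_+ 0) p≡q

meet-sym : ∀ {m p q u v} → Meet m p q u v → Meet m q p v u
meet-sym (x , y , x⊑u , y⊑v , eq) = y , x , y⊑v , x⊑u , sym eq

meet-step : ∀ {m p q u v} c → Meet m (p + letterWeight m c) q u v → Meet m p q (c ∷ u) v
meet-step {m} {p} c (x , y , x⊑u , y⊑v , eq) =
  c ∷ x , y , refl ∷ x⊑u , y⊑v , trans (sym (+-assoc p (letterWeight m c) (weight m x))) eq

reach-step : ∀ {m T p} c u → T ≤ p + weight m (c ∷ u) → T ≤ p + letterWeight m c + weight m u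
reach-step {p = p} c u reach = ≤-trans reach (≤-reflexive (sym (+-assoc p _ _)))

-- The budget invariant survives when the lagging walk overtakes the leader:
-- its overshoot is paid for by the b-count of its first letter.
overtake-budget : ∀ {m T p q} c u v → p < q →
  q + m * (count-b (c ∷ u) + count-b v) ≤ T →
  p + letterWeight m c + m * (count-b v + count-b u) ≤ T
overtake-budget {m} {T} {p} {q} c u v p<q budget = begin
  p + L + m * (V + U)             ≡⟨ regroup p L m U V ⟩
  p + (L + m * U) + m * V         ≡⟨ cong (λ k → p + k + m * V) (letter-cost m c u) ⟩
  p + suc (m * C) + m * V         ≡⟨ collect p m C V ⟩
  suc p + m * (C + V)             ≤⟨ +-monoˡ-≤ (m * (C + V)) p<q ⟩
  q + m * (C + V)                 ≤⟨ budget ⟩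
  T                               ∎
  where
  open ≤-Reasoning
  L = letterWeight m c
  U = count-b u
  V = count-b v
  C = count-b (c ∷ u)
  regroup : ∀ p L m U V → p + L + m * (V + U) ≡ p + (L + m * U) + m * V
  regroup = solve 5 (λ p L m U V → p :+ L :+ m :* (V :+ U) := p :+ (L :+ m :* U) :+ m :* V) refl
  collect : ∀ p m C V → p + suc (m * C) + m * V ≡ suc p + m * (C + V)
  collect = solve 4 (λ p m C V → p :+ (con 1 :+ m :* C) :+ m :* V := con 1 :+ p :+ m :* (C :+ V)) refl

leapfrog : ∀ {m T} p q u v → p ≤ q →
  q + m * (count-b u + count-b v) ≤ T → T ≤ p + weight m u → T ≤ q + weight m v →
  Meet m p q u v
leapfrog p q [] v p≤q budget reach-u _ =
  meet-here (≤-antisym p≤q q≤p)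
  where
  q≤p : q ≤ p
  q≤p = ≤-trans (m≤m+n q _) (≤-trans budget (≤-trans reach-u (≤-reflexive (+-identityʳ p))))
leapfrog {m} {T} p q (c ∷ u) v p≤q budget reach-u reach-v
  with m≤n⇒m<n∨m≡n p≤q | ≤-total (p + letterWeight m c) q
... | inj₂ p≡q | _ = meet-here p≡q
... | inj₁ p<q | inj₁ still-behind =
  meet-step c (leapfrog (p + letterWeight m c) q u v still-behind budget′ (reach-step c u reach-u) reach-v)
  where
  budget′ : q + m * (count-b u + count-b v) ≤ T
  budget′ = ≤-trans (+-monoʳ-≤ q (*-monoʳ-≤ m (+-monoˡ-≤ (count-b v) (count-b-cons c u)))) budget
... | inj₁ p<q | inj₂ overtakes =
  meet-step c (meet-sym (leapfrog q (p + letterWeight m c) v u overtakes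
    (overtake-budget c u v p<q budget) reach-v (reach-step c u reach-u)))

CommonWeight : ℕ → List Γ → List Γ → Set
CommonWeight m u v = Σ (List Γ) λ x → Σ (List Γ) λ y →
  IsPrefix x u × x ≢ [] × IsPrefix y v × y ≢ [] × weight m x ≡ weight m y

common-sym : ∀ {m u v} → CommonWeight m u v → CommonWeight m v u
common-sym (x , y , x⊑u , x≢[] , y⊑v , y≢[] , eq) = y , x , y⊑v , y≢[] , x⊑u , x≢[] , sym eq

meet⇒common : ∀ {m} c d u v → Meet m (letterWeight m c) (letterWeight m d) u v →
  CommonWeight m (c ∷ u) (d ∷ v)
meet⇒common c d u v (x , y , x⊑u , y⊑v , eq) =
  c ∷ x , d ∷ y , ⊑⇒IsPrefix (refl ∷ x⊑u) , (λ ()) , ⊑⇒IsPrefix (refl ∷ y⊑v) , (λ ()) , eq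

first-budget : ∀ m c d u v →
  letterWeight m d + m * (count-b u + count-b v) ≤ suc (m * (count-b (c ∷ u) + count-b (d ∷ v)))
first-budget m c d u v = begin
  L + m * (U + V)             ≡⟨ regroup L m U V ⟩
  m * U + (L + m * V)         ≡⟨ cong (m * U +_) (letter-cost m d v) ⟩
  m * U + suc (m * D)         ≤⟨ +-monoˡ-≤ (suc (m * D)) (*-monoʳ-≤ m (count-b-cons c u)) ⟩
  m * C + suc (m * D)         ≡⟨ collect m C D ⟩
  suc (m * (C + D))           ∎
  where
  open ≤-Reasoning
  L = letterWeight m d
  U = count-b u
  V = count-b v
  C = count-b (c ∷ u)
  D = count-b (d ∷ v)
  regroup : ∀ L m U V → L + m * (U + V) ≡ m * U + (L + m * V)
  regroup = solve 4 (λ L m U V → L :+ m :* (U :+ V) := m :* U :+ (L :+ m :* V)) refl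
  collect : ∀ m C D → m * C + suc (m * D) ≡ suc (m * (C + D))
  collect = solve 3 (λ m C D → m :* C :+ (con 1 :+ m :* D) := con 1 :+ m :* (C :+ D)) refl

lighter-first : ∀ m n c d u v → count-b (c ∷ u) + count-b (d ∷ v) ≤ n →
  letterWeight m c ≤ letterWeight m d →
  suc (m * n) ≤ weight m (c ∷ u) → suc (m * n) ≤ weight m (d ∷ v) →
  CommonWeight m (c ∷ u) (d ∷ v)
lighter-first m n c d u v count≤n c≤d reach-u reach-v =
  meet⇒common c d u v (leapfrog _ _ u v c≤d budget reach-u reach-v)
  where
  budget : letterWeight m d + m * (count-b u + count-b v) ≤ suc (m * n)
  budget = ≤-trans (first-budget m c d u v) (s≤s (*-monoʳ-≤ m count≤n))

lemma2p1 : (m : ℕ) (u v : List Γ) →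
    suc (m * count-b (u ++ v)) ≤ weight m u →
    suc (m * count-b (u ++ v)) ≤ weight m v →
    Σ (List Γ) λ x → Σ (List Γ) λ y →
      IsPrefix x u × x ≢ [] × IsPrefix y v × y ≢ [] × weight m x ≡ weight m y
lemma2p1 m []      v       () _
lemma2p1 m (c ∷ u) []      _  ()
lemma2p1 m (c ∷ u) (d ∷ v) reach-u reach-v with ≤-total (letterWeight m c) (letterWeight m d)
... | inj₁ c≤d = lighter-first m n c d u v count≤n c≤d reach-u reach-v
  where
  n = count-b (c ∷ u ++ d ∷ v)
  count≤n : count-b (c ∷ u) + count-b (d ∷ v) ≤ n
  count≤n = ≤-reflexive (sym (count-b-++ (c ∷ u) (d ∷ v)))
... | inj₂ d≤c = common-sym (lighter-first m n d c v u count≤n d≤c reach-v reach-u)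
  where
  n = count-b (c ∷ u ++ d ∷ v)
  count≤n : count-b (d ∷ v) + count-b (c ∷ u) ≤ n
  count≤n = ≤-reflexive (trans (+-comm (count-b (d ∷ v)) (count-b (c ∷ u))) (sym (count-b-++ (c ∷ u) (d ∷ v))))
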